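{- Let $k\geq 3$, $n\geq 1$. Every automorphism $g\in G(H_n^k)$ permutes the corner vertices $\{\overline{0_n},\overline{1_n},\ldots,\overline{(k-1)_n}\}$: for each $i\in\{0,\ldots,k-1\}$ there is a unique $j\in\{0,\ldots,k-1\}$ with $g(\overline{i_n})=\overline{j_n}$.
   Context: The Tower of Hanoi puzzle has $k$ pegs labeled $0,\ldots,k-1$ and $n$ disks labeled $0,\ldots,n-1$ by increasing size. A state is encoded by the string $a_{n-1}\cdots a_0$ with $a_i\in\{0,\ldots,k-1\}$ meaning disk $i$ lies on peg $a_i$. The graph $H_n^k$ has these $k^n$ strings as vertices, with a single edge between two vertices iff one is obtained from the other by one legal move (moving the smallest disk of some peg onto another peg that is empty or whose smallest disk is larger); equivalently, the strings differ in exactly one position $i$ and no $j<i$ has $a_j$ equal to either of the two differing values. $G(H_n^k)$ is the group of adjacency-preserving bijections of $V(H_n^k)$. For $i\in\{0,\ldots,k-1\}$, $\overline{i_n}$ denotes the string $ii\cdots i$ of length $n$ (all disks on peg $i$), called a corner (perfect) vertex. -}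

module Defs where

open import Data.Nat using (ℕ)
open import Data.Fin using (Fin; _<_)
open import Data.Vec using (Vec; lookup; replicate)
open import Data.Product using (Σ; _×_; ∃)
open import Relation.Binary.PropositionalEquality using (_≡_)
open import Relation.Nullary using (¬_)
open import Function.Bundles using (_⤖_; _⇔_; Bijection)

-- A state of the Tower of Hanoi with n disks and k pegs:
-- position i of the vector (disk i, disks ordered by increasing size)
-- holds the peg a_i on which disk i lies.
State : ℕ → ℕ → Set
State k n = Vec (Fin k) n

Adj : ∀ {k n} → State k n → State k n → Set
Adj {k} {n} a b =
  Σ (Fin n) λ i →
    ¬ (lookup a i ≡ lookup b i)
    × (∀ (j : Fin n) → ¬ (j ≡ i) → lookup a j ≡ lookup b j)
    × (∀ (j : Fin n) → j < i → ¬ (lookup a j ≡ lookup a i) × ¬ (lookup a j ≡ lookup b i))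

corner : ∀ {k} n → Fin k → State k n
corner n i = replicate n i

record Automorphism (k n : ℕ) : Set where
  field
    bij       : State k n ⤖ State k n
    preserves : ∀ (x y : State k n) →
                Adj x y ⇔ Adj (Bijection.to bij x) (Bijection.to bij y)

module Submission where

-- Call a vertex x simplicial if any two distinct neighbours of x are
-- adjacent to each other.  The proof rests on three facts:
--   * simpliciality is a graph invariant: any bijection that preserves and
--     reflects adjacency maps simplicial vertices to simplicial vertices;
--   * every corner is simplicial: a corner can only move its smallest
--     disk 0, so its neighbours differ from each other only in disk 0;
--   * for k ≥ 3 every simplicial vertex is a corner: if disk D > 0 is the
--     first disk off the peg p of disk 0, moving disk D to a third peg and
--     moving disk 0 onto disk D's peg give two neighbours that differ in
--     two positions, hence are not adjacent.
-- The image of a corner under an automorphism is therefore a corner, and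
-- the peg of that corner is unique because corners are determined by
-- their first entry.

open import Defs
open import Data.Nat using (ℕ; _+_; _≥_; s≤s; z≤n) renaming (suc to 1+_)
open import Data.Fin using (Fin; zero; suc; _<_)
open import Data.Fin.Properties using (_≟_)
open import Data.Vec using (Vec; []; _∷_; lookup; replicate; _[_]≔_; head)
open import Data.Vec.Properties using (lookup-replicate; lookup∘update; lookup∘update′)
open import Data.Vec.Relation.Binary.Pointwise.Extensional using (ext; Pointwise-≡⇒≡)
open import Data.Product using (Σ; ∃; _×_; _,_; proj₁; proj₂)
open import Data.Sum using (_⊎_; inj₁; inj₂)
open import Data.Empty using (⊥-elim)
open import Relation.Nullary using (¬_; yes; no)
open import Relation.Binary.PropositionalEquality using (_≡_; _≢_; refl; sym; trans; cong)
open import Function.Bundles using (_⤖_; _⇔_; Bijection; Equivalence)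

Simplicial : {A : Set} → (A → A → Set) → A → Set
Simplicial R x = ∀ y z → R x y → R x z → y ≢ z → R y z

simplicial-invariant : {A : Set} {R : A → A → Set} (f : A ⤖ A) →
  (∀ x y → R x y ⇔ R (Bijection.to f x) (Bijection.to f y)) →
  ∀ x → Simplicial R x → Simplicial R (Bijection.to f x)
simplicial-invariant f pres x simp y′ z′ xy′ xz′ y′≢z′
  with Bijection.strictlySurjective f y′ | Bijection.strictlySurjective f z′
... | y , refl | z , refl =
  Equivalence.to (pres y z)
    (simp y z (Equivalence.from (pres x y) xy′) (Equivalence.from (pres x z) xz′)
              (λ y≡z → y′≢z′ (cong (Bijection.to f) y≡z)))

two-differences-not-adjacent : ∀ {k n} {a b : State k n} {i j : Fin n} → i ≢ j →
  lookup a i ≢ lookup b i → lookup a j ≢ lookup b j → ¬ Adj a b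
two-differences-not-adjacent {i = i} {j} i≢j ai≢bi aj≢bj (t , _ , unchanged , _)
  with i ≟ t
... | yes refl = aj≢bj (unchanged j (λ j≡i → i≢j (sym j≡i)))
... | no i≢t   = ai≢bi (unchanged i i≢t)

move-adjacent : ∀ {k n} (x : State k n) (i : Fin n) (r : Fin k) → lookup x i ≢ r →
  (∀ j → j < i → lookup x j ≢ lookup x i × lookup x j ≢ r) → Adj x (x [ i ]≔ r)
move-adjacent x i r xi≢r smaller-free =
  i , (λ e → xi≢r (trans e (lookup∘update i x r)))
    , (λ j j≢i → sym (lookup∘update′ j≢i x r))
    , λ j j<i → let (≢src , ≢r) = smaller-free j j<i
                in ≢src , λ e → ≢r (trans e (lookup∘update i x r))

corner-neighbour : ∀ {k m} (p : Fin k) (y : State k (1+ m)) → Adj (corner (1+ m) p) y →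
  ∀ j → j ≢ zero → lookup y j ≡ p
corner-neighbour p y (zero , _ , unchanged , _) j j≢0 =
  trans (sym (unchanged j j≢0)) (lookup-replicate j p)
corner-neighbour p y (suc t , _ , _ , smaller-free) j j≢0 =
  ⊥-elim (proj₁ (smaller-free zero (s≤s z≤n)) (sym (lookup-replicate t p)))

-- Every corner is simplicial: two distinct neighbours differ only in disk
-- 0, and moving disk 0 is always legal.
corner-simplicial : ∀ {k m} (p : Fin k) → Simplicial Adj (corner (1+ m) p)
corner-simplicial p y z py pz y≢z = zero , y0≢z0 , agree , λ _ ()
  where
  agree : ∀ j → j ≢ zero → lookup y j ≡ lookup z j
  agree j j≢0 = trans (corner-neighbour p y py j j≢0) (sym (corner-neighbour p z pz j j≢0))
  y0≢z0 : lookup y zero ≢ lookup z zero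
  y0≢z0 e = y≢z (Pointwise-≡⇒≡ (ext λ { zero → e ; (suc j) → agree (suc j) (λ ()) }))

first-deviation : ∀ {k m} (p : Fin k) (w : Vec (Fin k) m) →
  w ≡ replicate m p ⊎ Σ (Fin m) λ d → lookup w d ≢ p × (∀ j → j < d → lookup w j ≡ p)
first-deviation p [] = inj₁ refl
first-deviation p (a ∷ w) with a ≟ p
... | no a≢p = inj₂ (zero , a≢p , λ _ ())
... | yes refl with first-deviation p w
...   | inj₁ w≡p = inj₁ (cong (a ∷_) w≡p)
...   | inj₂ (d , wd≢p , below) =
        inj₂ (suc d , wd≢p , λ { zero _ → refl ; (suc j) (s≤s j<d) → below j j<d })

third-peg : ∀ {k} (p q : Fin (3 + k)) → ∃ λ r → r ≢ p × r ≢ q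
third-peg zero          zero          = suc zero , (λ ()) , (λ ())
third-peg zero          (suc zero)    = suc (suc zero) , (λ ()) , (λ ())
third-peg zero          (suc (suc q)) = suc zero , (λ ()) , (λ ())
third-peg (suc zero)    zero          = suc (suc zero) , (λ ()) , (λ ())
third-peg (suc zero)    (suc q)       = zero , (λ ()) , (λ ())
third-peg (suc (suc p)) zero          = suc zero , (λ ()) , (λ ())
third-peg (suc (suc p)) (suc q)       = zero , (λ ()) , (λ ())

-- A state with disk 0 on peg p and some disk off p is not simplicial:
-- if disk 1+d is the first one off p, say on peg q, then moving it to a
-- third peg r and moving disk 0 onto q yield two neighbours that differ
-- in disk 0 (p ≠ q) and in disk 1+d (r ≠ q).
deviation-not-simplicial : ∀ {k m : ℕ} (p : Fin (3 + k)) (w : State (3 + k) m) →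
  (Σ (Fin m) λ d → lookup w d ≢ p × (∀ j → j < d → lookup w j ≡ p)) →
  ¬ Simplicial Adj (p ∷ w)
deviation-not-simplicial {k} {m} p w (d , q≢p , below) simp =
  two-differences-not-adjacent {a = y} {b = z} {i = zero} {j = suc d} (λ ())
    (λ p≡q → q≢p (sym p≡q)) (λ yd≡q → r≢q (trans (sym (lookup∘update d w r)) yd≡q))
    (simp y z xy xz (λ y≡z → q≢p (sym (cong head y≡z))))
  where
  x : State (3 + k) (1+ m)
  x = p ∷ w
  q : Fin (3 + k)
  q = lookup w d
  r : Fin (3 + k)
  r = proj₁ (third-peg p q)
  r≢p : r ≢ p
  r≢p = proj₁ (proj₂ (third-peg p q))
  r≢q : r ≢ q
  r≢q = proj₂ (proj₂ (third-peg p q))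
  y z : State (3 + k) (1+ m)
  y = x [ suc d ]≔ r
  z = x [ zero ]≔ q
  on-p : ∀ j → j < suc d → lookup x j ≡ p
  on-p zero    _         = refl
  on-p (suc j) (s≤s j<d) = below j j<d
  xy : Adj x y
  xy = move-adjacent x (suc d) r (λ q≡r → r≢q (sym q≡r))
         λ j j<1+d → (λ xj≡q → q≢p (trans (sym xj≡q) (on-p j j<1+d)))
                 , (λ xj≡r → r≢p (trans (sym xj≡r) (on-p j j<1+d)))
  xz : Adj x z
  xz = move-adjacent x zero q (λ p≡q → q≢p (sym p≡q)) λ _ ()

simplicial⇒corner : ∀ {k m} (x : State (3 + k) (1+ m)) → Simplicial Adj x →
  ∃ λ p → x ≡ corner (1+ m) p
simplicial⇒corner (p ∷ w) simp with first-deviation p w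
... | inj₁ w≡p      = p , cong (p ∷_) w≡p
... | inj₂ deviation = ⊥-elim (deviation-not-simplicial p w deviation simp)

corner-injective : ∀ {k m} {p q : Fin k} → corner (1+ m) p ≡ corner (1+ m) q → p ≡ q
corner-injective = cong head

lemma2 : ∀ (k n : ℕ) → k ≥ 3 → n ≥ 1 → (g : Automorphism k n) →
    ∀ (i : Fin k) → Σ (Fin k) λ j →
      (Bijection.to (Automorphism.bij g) (corner n i) ≡ corner n j)
      × (∀ (j′ : Fin k) → Bijection.to (Automorphism.bij g) (corner n i) ≡ corner n j′ → j′ ≡ j)
lemma2 (1+ (1+ (1+ k))) (1+ m) (s≤s (s≤s (s≤s _))) (s≤s _) g i
  with simplicial⇒corner (Bijection.to (Automorphism.bij g) (corner (1+ m) i))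
         (simplicial-invariant (Automorphism.bij g) (Automorphism.preserves g)
            (corner (1+ m) i) (corner-simplicial i))
... | j , gi≡j = j , gi≡j , λ j′ gi≡j′ → corner-injective (trans (sym gi≡j′) gi≡j)
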